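{- Let $G$ be a graph. Then $\mathcal{S}(G)$ contains a combinatorially orthogonal matrix if and only if the matrix $A(G)+I$ is combinatorially orthogonal, where $A(G)$ is the adjacency matrix of $G$.
   Context: All graphs are simple, finite and undirected. For a graph $G$ on $n$ vertices, $\mathcal{S}(G)$ is the set of real symmetric $n\times n$ matrices $A=[a_{i,j}]$ such that for $i\neq j$, $a_{i,j}\neq 0$ if and only if $\{i,j\}\in E(G)$ (diagonal entries are unrestricted). Two vectors $x,y\in\mathbb{R}^n$ are combinatorially orthogonal if $|\operatorname{supp}(x)\cap\operatorname{supp}(y)|\neq 1$, where $\operatorname{supp}(x)=\{i: x_i\neq 0\}$. A matrix is combinatorially orthogonal if its rows are pairwise combinatorially orthogonal and its columns are pairwise combinatorially orthogonal.
   Formalization: The matrices in $\mathcal{S}(G)$ have rational entries rather than real ones. -}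

module Defs where

open import Data.Nat using (ℕ)
open import Data.Bool using (Bool; true; false; if_then_else_; _∧_; T)
open import Data.Fin using (Fin; _≟_)
open import Data.List using (List; map; allFin)
open import Data.Nat.ListAction using (sum)
open import Data.Rational using (ℚ; 0ℚ; 1ℚ; _+_)
import Data.Rational.Properties as ℚP
open import Relation.Nullary using (¬_; does)
open import Relation.Binary.PropositionalEquality using (_≡_; _≢_)
open import Function.Bundles using (_⇔_)
open import Data.Product using (_×_)

record Graph (n : ℕ) : Set where
  field
    adj     : Fin n → Fin n → Bool
    adj-sym : ∀ i j → adj i j ≡ adj j i
    adj-irr : ∀ i → adj i i ≡ false
open Graph public

Matrix : ℕ → Set
Matrix n = Fin n → Fin n → ℚ

nz : ℚ → Bool
nz q = if does (q ℚP.≟ 0ℚ) then false else true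

suppMeet : ∀ {n} → (Fin n → ℚ) → (Fin n → ℚ) → ℕ
suppMeet {n} x y = sum (map (λ k → if nz (x k) ∧ nz (y k) then 1 else 0) (allFin n))

CombOrthVec : ∀ {n} → (Fin n → ℚ) → (Fin n → ℚ) → Set
CombOrthVec x y = suppMeet x y ≢ 1

row : ∀ {n} → Matrix n → Fin n → Fin n → ℚ
row M i = λ k → M i k

col : ∀ {n} → Matrix n → Fin n → Fin n → ℚ
col M j = λ k → M k j

CombOrth : ∀ {n} → Matrix n → Set
CombOrth {n} M =
  (∀ (i j : Fin n) → i ≢ j → CombOrthVec (row M i) (row M j)) ×
  (∀ (i j : Fin n) → i ≢ j → CombOrthVec (col M i) (col M j))

-- membership in S(G) (entries taken in ℚ)
InS : ∀ {n} → Graph n → Matrix n → Set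
InS {n} G A =
  (∀ (i j : Fin n) → A i j ≡ A j i) ×
  (∀ (i j : Fin n) → i ≢ j → ((A i j ≢ 0ℚ) ⇔ T (adj G i j)))

adjMatrix : ∀ {n} → Graph n → Matrix n
adjMatrix G i j = if adj G i j then 1ℚ else 0ℚ

idMatrix : ∀ {n} → Matrix n
idMatrix i j = if does (i ≟ j) then 1ℚ else 0ℚ

adjPlusI : ∀ {n} → Graph n → Matrix n
adjPlusI G i j = adjMatrix G i j + idMatrix i j

-- If i ≠ j are
-- nonadjacent, the entries (i, j) and (j, i) vanish, so the common support of rows i and
-- j is exactly the common neighbourhood of i and j, whatever the matrix.  If i and j are
-- adjacent and the diagonal is nonzero, as in A(G) + I, rows i and j share the positions
-- i and j.  So a combinatorially orthogonal A ∈ S(G) forces the rows of A(G) + I to be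
-- combinatorially orthogonal, and by symmetry its columns too; conversely A(G) + I ∈ S(G).
module Submission where

open import Defs
open import Data.Bool using (Bool; true; false; if_then_else_; _∧_; T)
open import Data.Bool.Properties using (∧-zeroʳ)
open import Data.Empty using (⊥-elim)
open import Data.Fin using (Fin; zero; suc; _≟_)
open import Data.List using (allFin; tabulate)
open import Data.List.Properties using (map-cong; map-tabulate)
open import Data.Nat using (ℕ; _+_; _≤_)
open import Data.Nat.ListAction using (sum)
open import Data.Nat.Properties
  using (≤-trans; ≤-reflexive; +-comm; +-monoʳ-≤; m≤m+n; m≤n+m; >⇒≢)
open import Data.Product using (∃; _×_; _,_)
open import Data.Rational using (ℚ; 0ℚ; 1ℚ)
import Data.Rational.Properties as ℚ
open import Data.Unit using (tt)
open import Function using (_∘_; case_of_)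
open import Function.Bundles using (_⇔_; mk⇔; Equivalence)
open import Relation.Binary.PropositionalEquality
open ≡-Reasoning
open import Relation.Nullary using (yes; no)

private
  variable
    n : ℕ

lookup≤sum-tabulate : (g : Fin n → ℕ) (i : Fin n) → g i ≤ sum (tabulate g)
lookup≤sum-tabulate g zero    = m≤m+n (g zero) _
lookup≤sum-tabulate g (suc i) =
  ≤-trans (lookup≤sum-tabulate (λ k → g (suc k)) i) (m≤n+m _ (g zero))

lookup+lookup≤sum-tabulate : (g : Fin n → ℕ) {i j : Fin n} → i ≢ j →
                             g i + g j ≤ sum (tabulate g)
lookup+lookup≤sum-tabulate g {zero}  {zero}  i≢j = ⊥-elim (i≢j refl)
lookup+lookup≤sum-tabulate g {zero}  {suc j} _   =
  +-monoʳ-≤ (g zero) (lookup≤sum-tabulate (λ k → g (suc k)) j)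
lookup+lookup≤sum-tabulate g {suc i} {zero}  _   =
  ≤-trans (≤-reflexive (+-comm (g (suc i)) (g zero)))
          (+-monoʳ-≤ (g zero) (lookup≤sum-tabulate (λ k → g (suc k)) i))
lookup+lookup≤sum-tabulate g {suc i} {suc j} i≢j =
  ≤-trans (lookup+lookup≤sum-tabulate (λ k → g (suc k)) (i≢j ∘ cong suc))
          (m≤n+m _ (g zero))

nz≡ : {q : ℚ} {b : Bool} → (q ≢ 0ℚ) ⇔ T b → nz q ≡ b
nz≡ {q} {b} q≢0⇔b with q ℚ.≟ 0ℚ | b
... | yes q≡0 | true  = ⊥-elim (Equivalence.from q≢0⇔b tt q≡0)
... | yes _   | false = refl
... | no _    | true  = refl
... | no q≢0  | false = ⊥-elim (Equivalence.to q≢0⇔b q≢0)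

commonSupport : (x y : Fin n → ℚ) → Fin n → Bool
commonSupport x y k = nz (x k) ∧ nz (y k)

indicator : Bool → ℕ
indicator b = if b then 1 else 0

suppMeet≡sum-tabulate : (x y : Fin n → ℚ) →
                        suppMeet x y ≡ sum (tabulate (λ k → indicator (commonSupport x y k)))
suppMeet≡sum-tabulate x y =
  cong sum (map-tabulate (λ k → k) (λ k → indicator (commonSupport x y k)))

suppMeet-cong : (x y x′ y′ : Fin n → ℚ) →
                (∀ k → commonSupport x y k ≡ commonSupport x′ y′ k) →
                suppMeet x y ≡ suppMeet x′ y′
suppMeet-cong {n} x y x′ y′ pointwise =
  cong sum (map-cong (λ k → cong indicator (pointwise k)) (allFin n))

2≤suppMeet : (x y : Fin n → ℚ) {i j : Fin n} → i ≢ j →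
             commonSupport x y i ≡ true → commonSupport x y j ≡ true →
             2 ≤ suppMeet x y
2≤suppMeet x y i≢j i∈xy j∈xy =
  subst (2 ≤_) (sym (suppMeet≡sum-tabulate x y))
        (subst₂ (λ a b → indicator a + indicator b ≤ sum (tabulate common)) i∈xy j∈xy
                (lookup+lookup≤sum-tabulate common i≢j))
  where
    common : Fin _ → ℕ
    common k = indicator (commonSupport x y k)

RowsCombOrth ColsCombOrth : Matrix n → Set
RowsCombOrth {n} M = ∀ (i j : Fin n) → i ≢ j → CombOrthVec (row M i) (row M j)
ColsCombOrth {n} M = ∀ (i j : Fin n) → i ≢ j → CombOrthVec (col M i) (col M j)

Symmetric : Matrix n → Set
Symmetric {n} M = ∀ (i j : Fin n) → M i j ≡ M j i

symmetric-rows⇒cols : {M : Matrix n} → Symmetric M → RowsCombOrth M → ColsCombOrth M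
symmetric-rows⇒cols {M = M} sym-M rows i j i≢j =
  subst (_≢ 1) (suppMeet-cong (row M i) (row M j) (col M i) (col M j)
                               (λ k → cong₂ (λ a b → nz a ∧ nz b) (sym-M i k) (sym-M j k)))
        (rows i j i≢j)

module _ (G : Graph n) where

  nz-offDiagonal : {A : Matrix n} → InS G A → {i j : Fin n} → i ≢ j →
                   nz (A i j) ≡ adj G i j
  nz-offDiagonal (_ , offDiagonal) i≢j = nz≡ (offDiagonal _ _ i≢j)

  nonadjacent-commonSupport : {A : Matrix n} → InS G A → {i j : Fin n} → i ≢ j →
                              adj G i j ≡ false → ∀ k →
                              commonSupport (row A i) (row A j) k ≡ adj G i k ∧ adj G j k
  nonadjacent-commonSupport {A} A∈S {i} {j} i≢j nonadj k with k ≟ i | k ≟ j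
  ... | yes refl | _
    rewrite nz-offDiagonal A∈S (i≢j ∘ sym) | adj-sym G j k | nonadj | adj-irr G k =
      ∧-zeroʳ _
  ... | no _ | yes refl
    rewrite nz-offDiagonal A∈S i≢j | nonadj = refl
  ... | no k≢i | no k≢j =
    cong₂ _∧_ (nz-offDiagonal A∈S (k≢i ∘ sym)) (nz-offDiagonal A∈S (k≢j ∘ sym))

  nonadjacent-suppMeet : {A B : Matrix n} → InS G A → InS G B → {i j : Fin n} → i ≢ j →
                         adj G i j ≡ false →
                         suppMeet (row A i) (row A j) ≡ suppMeet (row B i) (row B j)
  nonadjacent-suppMeet {A} {B} A∈S B∈S {i} {j} i≢j nonadj =
    suppMeet-cong (row A i) (row A j) (row B i) (row B j) λ k →
      trans (nonadjacent-commonSupport A∈S i≢j nonadj k)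
            (sym (nonadjacent-commonSupport B∈S i≢j nonadj k))

  adjacent-2≤suppMeet : {B : Matrix n} → InS G B → (∀ i → nz (B i i) ≡ true) →
                        {i j : Fin n} → i ≢ j → adj G i j ≡ true →
                        2 ≤ suppMeet (row B i) (row B j)
  adjacent-2≤suppMeet {B} B∈S diag {i} {j} i≢j adjacent =
    2≤suppMeet (row B i) (row B j) i≢j
      (cong₂ _∧_ (diag i)
                 (trans (nz-offDiagonal B∈S (i≢j ∘ sym)) (trans (adj-sym G j i) adjacent)))
      (cong₂ _∧_ (trans (nz-offDiagonal B∈S i≢j) adjacent) (diag j))

  rowsCombOrth-transfer : {A B : Matrix n} → InS G A → InS G B → (∀ i → nz (B i i) ≡ true) →
                   RowsCombOrth A → RowsCombOrth B
  rowsCombOrth-transfer A∈S B∈S diag rows i j i≢j with adj G i j in eq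
  ... | true  = >⇒≢ (adjacent-2≤suppMeet B∈S diag i≢j eq)
  ... | false = subst (_≢ 1) (nonadjacent-suppMeet A∈S B∈S i≢j eq) (rows i j i≢j)

  adjPlusI-diagonal : (i : Fin n) → adjPlusI G i i ≡ 1ℚ
  adjPlusI-diagonal i with i ≟ i
  ... | yes _   rewrite adj-irr G i = ℚ.+-identityˡ 1ℚ
  ... | no i≢i  = ⊥-elim (i≢i refl)

  nz-adjPlusI-diagonal : (i : Fin n) → nz (adjPlusI G i i) ≡ true
  nz-adjPlusI-diagonal i = cong nz (adjPlusI-diagonal i)

  adjPlusI-offDiagonal : {i j : Fin n} → i ≢ j → adjPlusI G i j ≡ adjMatrix G i j
  adjPlusI-offDiagonal {i} {j} i≢j with i ≟ j
  ... | yes i≡j = ⊥-elim (i≢j i≡j)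
  ... | no _    = ℚ.+-identityʳ (adjMatrix G i j)

  adjMatrix-nonzero⇔adj : (i j : Fin n) → (adjMatrix G i j ≢ 0ℚ) ⇔ T (adj G i j)
  adjMatrix-nonzero⇔adj i j with adj G i j
  ... | true  = mk⇔ (λ _ → tt) (λ _ ())
  ... | false = mk⇔ (λ 0≢0 → 0≢0 refl) (λ ())

  adjPlusI-symmetric : Symmetric (adjPlusI G)
  adjPlusI-symmetric i j = case i ≟ j of λ where
    (yes i≡j) → cong₂ (adjPlusI G) i≡j (sym i≡j)
    (no i≢j)  → begin
      adjPlusI G i j  ≡⟨ adjPlusI-offDiagonal i≢j ⟩
      adjMatrix G i j ≡⟨ cong (λ b → if b then 1ℚ else 0ℚ) (adj-sym G i j) ⟩
      adjMatrix G j i ≡⟨ adjPlusI-offDiagonal (i≢j ∘ sym) ⟨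
      adjPlusI G j i  ∎

  adjPlusI∈S : InS G (adjPlusI G)
  adjPlusI∈S = adjPlusI-symmetric , λ i j i≢j →
    subst (λ q → (q ≢ 0ℚ) ⇔ T (adj G i j)) (sym (adjPlusI-offDiagonal i≢j))
          (adjMatrix-nonzero⇔adj i j)

lemma4p1 : ∀ (n : ℕ) (G : Graph n) →
    (∃ λ (A : Matrix n) → InS G A × CombOrth A) ⇔ CombOrth (adjPlusI G)
lemma4p1 n G = mk⇔
  (λ { (A , A∈S , rowsA , _) →
         let rowsP = rowsCombOrth-transfer G A∈S (adjPlusI∈S G)
                                           (nz-adjPlusI-diagonal G) rowsA
         in rowsP , symmetric-rows⇒cols (adjPlusI-symmetric G) rowsP })
  (λ combOrth → adjPlusI G , adjPlusI∈S G , combOrth)
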